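{- Let $p,p'$ be coprime with $1\le p<p'$, let $p'/p$ have continued fraction $[c_0,c_1,\ldots,c_n]$ with $c_0=1$, and let $y_k,z_k,\kappa_j,\tilde\kappa_j$ be its associated parameters. Let $y'_k,z'_k,\kappa'_j,\tilde\kappa'_j$ be the corresponding parameters for $p'/(p'-p)$, whose continued fraction is $[c_1+1,c_2,\ldots,c_n]$ (its rank is again $t$). Then $y_k=y'_{k-1}$ and $z_k=y'_{k-1}-z'_{k-1}$ for $1\le k\le n$, and $\kappa_j=\kappa'_j$ and $\tilde\kappa_j=\kappa'_j-\tilde\kappa'_j$ for $1\le j\le t$.
   Context: For coprime $1\le q<q'$, write $q'/q=c_0+1/(c_1+1/(\cdots+1/c_n))$ with $c_i\ge1$ for $i<n$ and $c_n\ge2$ (the continued fraction $[c_0,\ldots,c_n]$, with height $n$). Set $t_k=-1+\sum_{i=0}^{k-1}c_i$ for $0\le k\le n+1$ and rank $t=t_{n+1}-1$. Define $y_{ -1}=0,y_0=1$, $z_{ -1}=1,z_0=0$ and $y_k=c_{k-1}y_{k-1}+y_{k-2}$, $z_k=c_{k-1}z_{k-1}+z_{k-2}$ for $1\le k\le n+1$. For $0\le k\le n$ and $t_k<j\le t_{k+1}$ set $\kappa_j=y_{k-1}+(j-t_k)y_k$ and $\tilde\kappa_j=z_{k-1}+(j-t_k)z_k$. -}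

module Defs where

open import Data.Nat using (ℕ; zero; suc; _+_; _*_; _∸_; _≤_; _<_; _<?_)
open import Data.List using (List; []; _∷_; length; take)
open import Data.Nat.ListAction using (sum)
open import Data.Product using (_×_; _,_; proj₁; proj₂)
open import Data.Empty using (⊥)
open import Relation.Binary.PropositionalEquality using (_≡_)
open import Relation.Nullary using (yes; no)

-- c_i : the i-th entry of the list [c_0, …, c_n] (0 outside the range; never used there)
at : List ℕ → ℕ → ℕ
at []       _       = 0
at (c ∷ _)  zero    = c
at (_ ∷ cs) (suc i) = at cs i

ValidCF : List ℕ → Set
ValidCF []           = ⊥
ValidCF (c ∷ [])     = 2 ≤ c
ValidCF (c ∷ d ∷ cs) = 1 ≤ c × ValidCF (d ∷ cs)

-- Value of a continued fraction as a (numerator , denominator) pair: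
-- [c] = c/1 and [c, rest] = c + 1/[rest]  (the empty list plays the role of 1/0).
cfVal : List ℕ → ℕ × ℕ
cfVal []       = 1 , 0
cfVal (c ∷ cs) with cfVal cs
... | a , b = c * a + b , a

-- "q'/q has continued fraction cs":  cs is a valid CF whose value equals q'/q
-- (equality of fractions by cross-multiplication).
IsCF : ℕ → ℕ → List ℕ → Set
IsCF q' q cs = ValidCF cs × q' * proj₂ (cfVal cs) ≡ proj₁ (cfVal cs) * q

height : List ℕ → ℕ
height cs = length cs ∸ 1

-- T k = c_0 + … + c_{k-1} = t_k + 1   (shifted by one to stay in ℕ; t_0 = -1)
T : List ℕ → ℕ → ℕ
T cs k = sum (take k cs)

-- rank t = t_{n+1} - 1 = (c_0 + … + c_n) - 2
rank : List ℕ → ℕ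
rank cs = sum cs ∸ 2

-- pairs (y_{k-1}, y_k) and (z_{k-1}, z_k)
yPair : List ℕ → ℕ → ℕ × ℕ
yPair cs zero    = 0 , 1
yPair cs (suc k) with yPair cs k
... | a , b = b , at cs k * b + a

zPair : List ℕ → ℕ → ℕ × ℕ
zPair cs zero    = 1 , 0
zPair cs (suc k) with zPair cs k
... | a , b = b , at cs k * b + a

y : List ℕ → ℕ → ℕ
y cs k = proj₂ (yPair cs k)

z : List ℕ → ℕ → ℕ
z cs k = proj₂ (zPair cs k)

-- the segment index k with t_k < j ≤ t_{k+1}, i.e. T k ≤ j < T (k+1);
-- seg cs acc j searches starting from running sum acc.
seg : List ℕ → ℕ → ℕ → ℕ
seg []       acc j = 0
seg (c ∷ cs) acc j with j <? acc + c
... | yes _ = 0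
... | no  _ = suc (seg cs (acc + c) j)

segIdx : List ℕ → ℕ → ℕ
segIdx cs j = seg cs 0 j

-- κ_j = y_{k-1} + (j - t_k) y_k   and   κ̃_j = z_{k-1} + (j - t_k) z_k,
-- where j - t_k = j + 1 - T k.
κ : List ℕ → ℕ → ℕ
κ cs j = proj₁ (yPair cs k) + (j + 1 ∸ T cs k) * y cs k
  where k = segIdx cs j

κ̃ : List ℕ → ℕ → ℕ
κ̃ cs j = proj₁ (zPair cs k) + (j + 1 ∸ T cs k) * z cs k
  where k = segIdx cs j

{-# OPTIONS --safe #-}
-- Since c₀ = 1 we have p′/p = 1 + 1/x with x = [c₁, …, c_n], hence
-- p′/(p′ − p) = 1 + x = [c₁ + 1, c₂, …, c_n], and by uniqueness of continued
-- fractions this is the expansion cs′.  The two expansions then share every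
-- partial quotient after their first, and the recurrences for (y, z) are linear
-- in their initial pairs, so each identity only has to be checked at its first
-- one or two indices.  The segment boundaries agree too (t_{k+1} = t′_k for k ≥ 1), except
-- t_1 = 0 against t′_0 = −1, which only moves j = 0.
module Submission where

open import Defs
open import Data.Nat using (ℕ; zero; suc; _+_; _*_; _∸_; _≤_; _<_; z≤n; s≤s; _<?_; NonZero; >-nonZero)
open import Data.Nat.Properties
open import Data.Nat.DivMod using (_/_; +-distrib-/-∣ʳ; m<n⇒m/n≡0; m*n/n≡m)
open import Data.Nat.Divisibility using (divides-refl)
open import Data.Nat.Tactic.RingSolver using (solve-∀)
open import Algebra.Properties.CommutativeSemigroup *-commutativeSemigroup using (xy∙z≈xz∙y)
open import Data.Nat.Coprimality using (Coprime)
open import Data.List using (List; []; _∷_)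
open import Data.Product using (_×_; _,_; proj₁; proj₂)
open import Data.Empty using (⊥-elim)
open import Relation.Nullary using (¬_; yes; no)
open import Relation.Binary.PropositionalEquality

infix 4 _≃_

-- With this, the second half of IsCF q′ q cs is literally (q′ , q) ≃ cfVal cs.

_≃_ : ℕ × ℕ → ℕ × ℕ → Set
(a , b) ≃ (c , d) = a * d ≡ c * b

≃-trans : ∀ {x y z} → 0 < proj₂ y → x ≃ y → y ≃ z → x ≃ z
≃-trans {a , b} {c , d} {e , f} d>0 ad≡cb cf≡ed = *-cancelʳ-≡ (a * f) (e * b) d (begin
  a * f * d ≡⟨ xy∙z≈xz∙y a f d ⟩
  a * d * f ≡⟨ cong (_* f) ad≡cb ⟩
  c * b * f ≡⟨ xy∙z≈xz∙y c b f ⟩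
  c * f * b ≡⟨ cong (_* b) cf≡ed ⟩
  e * d * b ≡⟨ xy∙z≈xz∙y e d b ⟩
  e * b * d ∎)
  where
  open ≡-Reasoning
  instance _ = >-nonZero d>0

complement : ℕ × ℕ → ℕ × ℕ
complement (a , b) = a , a ∸ b

≃-complement : ∀ {x y} → x ≃ y → complement x ≃ complement y
≃-complement {a , b} {n , d} ad≡nb = begin
  a * (n ∸ d)   ≡⟨ *-distribˡ-∸ a n d ⟩
  a * n ∸ a * d ≡⟨ cong₂ _∸_ (*-comm a n) ad≡nb ⟩
  n * a ∸ n * b ≡⟨ *-distribˡ-∸ n a b ⟨
  n * (a ∸ b)   ∎
  where open ≡-Reasoning

[r+q*n]/n≡q : ∀ {n r} q .{{_ : NonZero n}} → r < n → (r + q * n) / n ≡ q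
[r+q*n]/n≡q {n} {r} q r<n = begin
  (r + q * n) / n     ≡⟨ +-distrib-/-∣ʳ r (divides-refl q) ⟩
  r / n + q * n / n   ≡⟨ cong₂ _+_ (m<n⇒m/n≡0 r<n) (m*n/n≡m q n) ⟩
  q                   ∎
  where open ≡-Reasoning

divMod-unique : ∀ {n q q′ r r′} → r < n → r′ < n → r + q * n ≡ r′ + q′ * n → r ≡ r′ × q ≡ q′
divMod-unique {n} {q} {q′} {r} {r′} r<n r′<n eq = +-cancelʳ-≡ (q * n) r r′ eq′ , q≡q′
  where
  instance _ = >-nonZero (≤-<-trans z≤n r<n)
  q≡q′ : q ≡ q′
  q≡q′ = trans (sym ([r+q*n]/n≡q q r<n)) (trans (cong (_/ n) eq) ([r+q*n]/n≡q q′ r′<n))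
  eq′ : r + q * n ≡ r′ + q * n
  eq′ = trans eq (cong (λ k → r′ + k * n) (sym q≡q′))

num den : List ℕ → ℕ
num cs = proj₁ (cfVal cs)
den cs = proj₂ (cfVal cs)

mutual
  den<num : ∀ cs → ValidCF cs → den cs < num cs
  den<num (c ∷ []) 2≤c = subst (1 <_) (sym (trans (+-identityʳ (c * 1)) (*-identityʳ c))) 2≤c
  den<num (c ∷ d ∷ ds) (1≤c , v) = begin-strict
    num (d ∷ ds)                     <⟨ m<m+n (num (d ∷ ds)) (den>0 (d ∷ ds) v) ⟩
    num (d ∷ ds) + den (d ∷ ds)      ≤⟨ +-monoˡ-≤ (den (d ∷ ds)) (m≤n*m (num (d ∷ ds)) c) ⟩
    c * num (d ∷ ds) + den (d ∷ ds)  ∎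
    where
    open ≤-Reasoning
    instance _ = >-nonZero 1≤c

  den>0 : ∀ cs → ValidCF cs → 0 < den cs
  den>0 (c ∷ [])     _       = s≤s z≤n
  den>0 (c ∷ d ∷ ds) (_ , v) = ≤-<-trans z≤n (den<num (d ∷ ds) v)

den<num-tail : ∀ c cs → ValidCF (c ∷ cs) → den cs < num cs
den<num-tail c []       _       = s≤s z≤n
den<num-tail c (d ∷ ds) (_ , v) = den<num (d ∷ ds) v

cfVal-[]≄ : ∀ cs → ValidCF cs → ¬ (cfVal [] ≃ cfVal cs)
cfVal-[]≄ cs v eq = <⇒≢ (den>0 cs v) (sym (begin
  den cs          ≡⟨ *-identityˡ (den cs) ⟨
  1 * den cs      ≡⟨ eq ⟩
  num cs * 0      ≡⟨ *-zeroʳ (num cs) ⟩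
  0               ∎))
  where open ≡-Reasoning

cfVal-∷-≃ : ∀ {c d as bs} → ValidCF (c ∷ as) → ValidCF (d ∷ bs) →
            cfVal (c ∷ as) ≃ cfVal (d ∷ bs) → c ≡ d × cfVal as ≃ cfVal bs
cfVal-∷-≃ {c} {d} {as} {bs} va vb eq = proj₂ split , tail≃
  where
  X = num as
  Y = den as
  X′ = num bs
  Y′ = den bs
  Y<X : Y < X
  Y<X = den<num-tail c as va
  Y′<X′ : Y′ < X′
  Y′<X′ = den<num-tail d bs vb
  instance
    _ = >-nonZero (≤-<-trans z≤n Y<X)
    _ = >-nonZero (≤-<-trans z≤n Y′<X′)
  expand : ∀ c x y x′ → y * x′ + c * (x * x′) ≡ (c * x + y) * x′
  expand = solve-∀
  split : Y * X′ ≡ Y′ * X × c ≡ d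
  split = divMod-unique (*-monoˡ-< X′ Y<X)
                        (subst (Y′ * X <_) (*-comm X′ X) (*-monoˡ-< X Y′<X′)) (begin
    Y * X′ + c * (X * X′)  ≡⟨ expand c X Y X′ ⟩
    (c * X + Y) * X′       ≡⟨ eq ⟩
    (d * X′ + Y′) * X      ≡⟨ expand d X′ Y′ X ⟨
    Y′ * X + d * (X′ * X)  ≡⟨ cong (λ k → Y′ * X + d * k) (*-comm X′ X) ⟩
    Y′ * X + d * (X * X′)  ∎)
    where open ≡-Reasoning
  tail≃ : cfVal as ≃ cfVal bs
  tail≃ = trans (*-comm X Y′) (trans (sym (proj₁ split)) (*-comm Y X′))

mutual
  cfVal-injective : ∀ {as bs} → ValidCF as → ValidCF bs → cfVal as ≃ cfVal bs → as ≡ bs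
  cfVal-injective {c ∷ as} {d ∷ bs} va vb eq with cfVal-∷-≃ va vb eq
  ... | refl , tail≃ = cong (c ∷_) (cfVal-injective-tail va vb tail≃)

  cfVal-injective-tail : ∀ {c d as bs} → ValidCF (c ∷ as) → ValidCF (d ∷ bs) →
                         cfVal as ≃ cfVal bs → as ≡ bs
  cfVal-injective-tail {as = []}    {[]}    _        _        _  = refl
  cfVal-injective-tail {as = []}    {_ ∷ _} _        (_ , vb) eq = ⊥-elim (cfVal-[]≄ _ vb eq)
  cfVal-injective-tail {as = _ ∷ _} {[]}    (_ , va) _        eq = ⊥-elim (cfVal-[]≄ _ va (sym eq))
  cfVal-injective-tail {as = _ ∷ _} {_ ∷ _} (_ , va) (_ , vb) eq = cfVal-injective va vb eq

cfVal-suc-head : ∀ c r → cfVal (suc c ∷ r) ≡ complement (cfVal (1 ∷ c ∷ r))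
cfVal-suc-head c r = cong₂ _,_ (regroup c v (den r)) (sym (begin
  1 * u + v ∸ u  ≡⟨ cong (λ k → k + v ∸ u) (*-identityˡ u) ⟩
  u + v ∸ u      ≡⟨ m+n∸m≡n u v ⟩
  v              ∎))
  where
  open ≡-Reasoning
  u = num (c ∷ r)
  v = num r
  regroup : ∀ c v w → suc c * v + w ≡ 1 * (c * v + w) + v
  regroup = solve-∀

ValidCF-suc-head : ∀ c r → ValidCF (c ∷ r) → ValidCF (suc c ∷ r)
ValidCF-suc-head c []      2≤c     = m≤n⇒m≤1+n 2≤c
ValidCF-suc-head c (_ ∷ _) (_ , v) = s≤s z≤n , v

IsCF-unique : ∀ {q′ q as bs} → 0 < q → IsCF q′ q as → IsCF q′ q bs → as ≡ bs
IsCF-unique {q′} {q} {as} {bs} q>0 (va , ha) (vb , hb) =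
  cfVal-injective va vb (≃-trans {cfVal as} {q′ , q} {cfVal bs} q>0 (sym ha) hb)

IsCF-complement : ∀ {p′ p} c r → IsCF p′ p (1 ∷ c ∷ r) → IsCF p′ (p′ ∸ p) (suc c ∷ r)
IsCF-complement {p′} {p} c r ((_ , v) , h) =
  ValidCF-suc-head c r v ,
  subst (complement (p′ , p) ≃_) (sym (cfVal-suc-head c r))
        (≃-complement {p′ , p} {cfVal (1 ∷ c ∷ r)} h)

infixl 6 _⊕_

_⊕_ : ℕ × ℕ → ℕ × ℕ → ℕ × ℕ
(a , b) ⊕ (c , d) = a + c , b + d

-- yPair cs (suc k) and zPair cs (suc k) reduce to step (at cs k) (… cs k).
step : ℕ → ℕ × ℕ → ℕ × ℕ
step a (u , v) = v , a * v + u

step-⊕ : ∀ a P Q → step a P ⊕ step a Q ≡ step a (P ⊕ Q)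
step-⊕ a (u , v) (u′ , v′) = cong (v + v′ ,_) (distrib a u v u′ v′)
  where
  distrib : ∀ a u v u′ v′ → a * v + u + (a * v′ + u′) ≡ a * (v + v′) + (u + u′)
  distrib = solve-∀

affine : ℕ × ℕ → ℕ → ℕ
affine (u , v) d = u + d * v

affine-⊕ : ∀ P Q d → affine P d + affine Q d ≡ affine (P ⊕ Q) d
affine-⊕ (u , v) (u′ , v′) d = distrib u v u′ v′ d
  where
  distrib : ∀ u v u′ v′ d → u + d * v + (u′ + d * v′) ≡ u + u′ + d * (v + v′)
  distrib = solve-∀

-- κ cs j and κ̃ cs j are definitionally κAt cs j (segIdx cs j) and κ̃At cs j (segIdx cs j).
κAt κ̃At : List ℕ → ℕ → ℕ → ℕ
κAt  cs j k = affine (yPair cs k) (j + 1 ∸ T cs k)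
κ̃At cs j k = affine (zPair cs k) (j + 1 ∸ T cs k)

module Complement (c : ℕ) (r : List ℕ) where

  cs cs′ : List ℕ
  cs  = 1 ∷ c ∷ r
  cs′ = suc c ∷ r

  yPair-shift : ∀ m → yPair cs (2 + m) ≡ yPair cs′ (1 + m)
  yPair-shift zero    = cong (1 ,_) (base c)
    where
    base : ∀ c → c * 1 + 1 ≡ suc c * 1 + 0
    base = solve-∀
  yPair-shift (suc m) = cong (step (at r m)) (yPair-shift m)

  zPair-shift : ∀ m → zPair cs (2 + m) ⊕ zPair cs′ (1 + m) ≡ yPair cs′ (1 + m)
  zPair-shift zero    = cong (1 ,_) (base c)
    where
    base : ∀ c → c * 1 + 0 + (suc c * 0 + 1) ≡ suc c * 1 + 0
    base = solve-∀
  zPair-shift (suc m) = trans (step-⊕ (at r m) _ _) (cong (step (at r m)) (zPair-shift m))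

  yz-shift : ∀ k → 1 ≤ k → (y cs k ≡ y cs′ (k ∸ 1)) × (z cs k + z cs′ (k ∸ 1) ≡ y cs′ (k ∸ 1))
  yz-shift 1             _ = refl , refl
  yz-shift (suc (suc m)) _ = cong proj₂ (yPair-shift m) , cong proj₂ (zPair-shift m)

  κAt-shift : ∀ j k → κAt cs j (suc k) ≡ κAt cs′ j k
  κAt-shift j zero    = trans (cong (λ d → 1 + d * 1) (m+n∸n≡m j 1)) (base j)
    where
    base : ∀ j → 1 + j * 1 ≡ (j + 1) * 1
    base = solve-∀
  κAt-shift j (suc m) = cong (λ P → affine P (j + 1 ∸ T cs′ (suc m))) (yPair-shift m)

  κ̃At-shift : ∀ j k → κ̃At cs j (suc k) + κ̃At cs′ j k ≡ κAt cs′ j k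
  κ̃At-shift j zero    = trans (cong (λ d → 0 + d * 1 + (1 + (j + 1) * 0)) (m+n∸n≡m j 1)) (base j)
    where
    base : ∀ j → 0 + j * 1 + (1 + (j + 1) * 0) ≡ (j + 1) * 1
    base = solve-∀
  κ̃At-shift j (suc m) = trans (affine-⊕ (zPair cs (2 + m)) (zPair cs′ (1 + m)) (j + 1 ∸ T cs′ (suc m)))
                               (cong (λ P → affine P (j + 1 ∸ T cs′ (suc m))) (zPair-shift m))

  segIdx-shift : ∀ j → 1 ≤ j → segIdx cs j ≡ suc (segIdx cs′ j)
  segIdx-shift (suc j) _ with suc j <? 1
  ... | yes (s≤s ())
  ... | no _ with suc j <? suc c
  ...   | yes _ = refl
  ...   | no _  = refl

  κκ̃-shift : ∀ j → 1 ≤ j → (κ cs j ≡ κ cs′ j) × (κ̃ cs j + κ̃ cs′ j ≡ κ cs′ j)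
  κκ̃-shift j 1≤j rewrite segIdx-shift j 1≤j =
    κAt-shift j (segIdx cs′ j) , κ̃At-shift j (segIdx cs′ j)

lemmaE2 : (p p' : ℕ) → Coprime p p' → 1 ≤ p → p < p' →
          (cs cs' : List ℕ) → IsCF p' p cs → at cs 0 ≡ 1 →
          IsCF p' (p' ∸ p) cs' →
          ((k : ℕ) → 1 ≤ k → k ≤ height cs →
             (y cs k ≡ y cs' (k ∸ 1)) × (z cs k + z cs' (k ∸ 1) ≡ y cs' (k ∸ 1)))
          × ((j : ℕ) → 1 ≤ j → j ≤ rank cs →
             (κ cs j ≡ κ cs' j) × (κ̃ cs j + κ̃ cs' j ≡ κ cs' j))
lemmaE2 p p' _ _ p<p' (1 ∷ c ∷ r) cs' cs-isCF refl cs'-isCF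
  with IsCF-unique {p'} (m<n⇒0<n∸m p<p') cs'-isCF (IsCF-complement c r cs-isCF)
... | refl = (λ k 1≤k _ → yz-shift k 1≤k) , (λ j 1≤j _ → κκ̃-shift j 1≤j)
  where open Complement c r
lemmaE2 _ _ _ _ _ []       _ (() , _)     _    _
lemmaE2 _ _ _ _ _ (_ ∷ []) _ (s≤s () , _) refl _
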